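{- The axiom system $\mathsf{EK}$ is complete for $\mathcal{L}_{E,K}$ with respect to the class of evidence models satisfying (E1): every formula of $\mathcal{L}_{E,K}$ that is true at every evidence scenario of every evidence model satisfying (E1) is a theorem of $\mathsf{EK}$.
   Context: $\mathcal{L}_{E,K}$ is generated by $\phi ::= p \mid \neg\phi \mid \phi\wedge\psi \mid E\phi \mid K\phi$ with $p$ in a countable set $\textsc{prop}$. An evidence model is $(X,\mathcal{E},I,v)$ with $X$ a nonempty set, $\mathcal{E}$ a nonempty set of evidence states, $I_e:X\to 2^X$ for each $e\in\mathcal{E}$, and $v:\textsc{prop}\to 2^X$. Let $U_e=\{x\in X : x\in I_e(x)\}$; an evidence scenario is a pair $(x,e)$ with $x\in U_e$. Condition (E1): $y\in I_e(x)$ implies $y\in I_e(y)$. Truth: $(x,e)\models p$ iff $x\in v(p)$; Booleans as usual; $(x,e)\models E\phi$ iff $I_e(x)\subseteq[\![\phi]\!]^e$; $(x,e)\models K\phi$ iff $\bigcup_{y\in X}I_e(y)\subseteq[\![\phi]\!]^e$, where $[\![\phi]\!]^e=\{y\in U_e : (y,e)\models\phi\}$. $\mathsf{EK}$ is: classical propositional logic with modus ponens; $\mathsf{S5}$ for $K$ (axioms $K(\phi\to\psi)\to(K\phi\to K\psi)$, $K\phi\to\phi$, $K\phi\to KK\phi$, $\neg K\phi\to K\neg K\phi$, necessitation for $K$); $\mathsf{KT}$ for $E$ (axioms $E(\phi\to\psi)\to(E\phi\to E\psi)$, $E\phi\to\phi$, necessitation for $E$); and the axiom $K\phi\to E\phi$.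 -}

module Defs where

open import Data.Nat using (ℕ)
open import Data.Bool using (Bool; true; false; not; _∧_)
open import Data.Product using (_×_; Σ; _,_)
open import Data.Empty using (⊥)
open import Relation.Nullary using (¬_)
open import Relation.Binary.PropositionalEquality using (_≡_)

data Form : Set where
  atom : ℕ → Form
  ~_   : Form → Form
  _∧'_ : Form → Form → Form
  E    : Form → Form
  K    : Form → Form

infixr 6 _∧'_
infixr 5 _⇒_

_⇒_ : Form → Form → Form
φ ⇒ ψ = ~ (φ ∧' (~ ψ))

-- Classical propositional logic: all substitution instances of tautologies,
-- i.e. formulas true under every Boolean valuation that treats
-- modal formulas (E φ, K φ) and atoms as propositional variables.
evalB : (Form → Bool) → Form → Bool
evalB w (atom p) = w (atom p)
evalB w (~ φ) = not (evalB w φ)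
evalB w (φ ∧' ψ) = evalB w φ ∧ evalB w ψ
evalB w (E φ) = w (E φ)
evalB w (K φ) = w (K φ)

Tautology : Form → Set
Tautology φ = (w : Form → Bool) → evalB w φ ≡ true

data ⊢_ : Form → Set where
  taut  : ∀ {φ} → Tautology φ → ⊢ φ
  mp    : ∀ {φ ψ} → ⊢ (φ ⇒ ψ) → ⊢ φ → ⊢ ψ
  K-K   : ∀ {φ ψ} → ⊢ (K (φ ⇒ ψ) ⇒ (K φ ⇒ K ψ))
  K-T   : ∀ {φ} → ⊢ (K φ ⇒ φ)
  K-4   : ∀ {φ} → ⊢ (K φ ⇒ K (K φ))
  K-5   : ∀ {φ} → ⊢ (~ (K φ) ⇒ K (~ (K φ)))
  K-nec : ∀ {φ} → ⊢ φ → ⊢ K φ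
  E-K   : ∀ {φ ψ} → ⊢ (E (φ ⇒ ψ) ⇒ (E φ ⇒ E ψ))
  E-T   : ∀ {φ} → ⊢ (E φ ⇒ φ)
  E-nec : ∀ {φ} → ⊢ φ → ⊢ E φ
  KE    : ∀ {φ} → ⊢ (K φ ⇒ E φ)

-- Evidence models (X, ℰ, I, v); subsets of X are predicates X → Set
record EvidenceModel : Set₁ where
  field
    X    : Set
    x₀   : X
    Ev   : Set
    e₀   : Ev
    I    : Ev → X → X → Set        -- I e x y  means  y ∈ I_e(x)
    val  : ℕ → X → Set             -- val p x  means  x ∈ v(p)

  U : Ev → X → Set
  U e x = I e x x

module _ (M : EvidenceModel) where
  open EvidenceModel M

  Sat : X → Ev → Form → Set
  Ext : Ev → Form → X → Set

  Sat x e (atom p) = val p x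
  Sat x e (~ φ) = ¬ Sat x e φ
  Sat x e (φ ∧' ψ) = Sat x e φ × Sat x e ψ
  Sat x e (E φ) = ∀ y → I e x y → Ext e φ y
  Sat x e (K φ) = ∀ z y → I e z y → Ext e φ y

  Ext e φ y = U e y × Sat y e φ

E1 : EvidenceModel → Set
E1 M = ∀ e x y → I e x y → I e y y
  where open EvidenceModel M

ValidE1 : Form → Set₁
ValidE1 φ = (M : EvidenceModel) → E1 M →
  ∀ x e → EvidenceModel.U M e x → Sat M x e φ

module Submission where

-- Completeness of EK with respect to evidence models satisfying (E1), by
-- Pratt-style elimination of assignments.
--
-- Every truth
-- assignment t to B has a characteristic formula  char t , which decides each
-- formula over B; jointly the characteristic formulas cover all cases.  We
-- repeatedly delete an assignment that is defective at some □ₘ a ∈ B (it makes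
-- □ₘ a true and a false, or □ₘ a false while every remaining assignment meeting
-- its m-requirement makes a true); each deleted assignment is refutable.  The
-- survivors agreeing with a fixed one on the K-formulas form an evidence model
-- satisfying (E1) with one evidence state and a truth lemma, so a valid formula
-- over B holds at all survivors and is a theorem ('complete').  corollary1 is
-- the instance B = atom 0 ∷ bas φ.

open import Defs
open import Data.Nat using (zero; suc; _≤_; _<_)
import Data.Nat as ℕ
open import Data.Nat.Properties using (≤-refl; ≤-trans; ≤-pred)
open import Data.Bool using (Bool; true; false; not; _∧_; if_then_else_)
import Data.Bool as Bool
import Data.Bool.Properties as Boolₚ
open import Data.Product using (_×_; _,_; proj₁; proj₂; Σ-syntax; ∃-syntax)
open import Data.Sum using (_⊎_; inj₁; inj₂; [_,_]′; map₂)
open import Data.Empty using (⊥-elim)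
open import Data.Unit using (⊤; tt)
open import Data.List using (List; []; _∷_; _++_; map; length; filter)
import Data.List.Properties as Listₚ
open import Data.List.Relation.Unary.All as All using (All; []; _∷_)
import Data.List.Relation.Unary.All.Properties as Allₚ
open import Data.List.Relation.Unary.Any as Any using (here; there)
open import Data.List.Membership.Propositional using (_∈_)
open import Data.List.Membership.Propositional.Properties using (∈-++⁺ˡ; ∈-++⁺ʳ; ∈-++⁻; ∈-map⁺; ∈-filter⁺)
open import Data.List.Relation.Binary.Subset.Propositional using (_⊆_)
open import Function using (_∘_; id)
open import Function.Bundles using (_⇔_; mk⇔; Equivalence)
open import Relation.Nullary using (¬_; Dec; yes; no; ¬?)
open import Relation.Nullary.Decidable using (decidable-stable; map′)
open import Relation.Binary.Definitions using (DecidableEquality)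
open import Relation.Binary.PropositionalEquality using (_≡_; refl; sym; trans; cong; cong₂; subst)

all-or-counterexample : {A : Set} {P Q : A → Set} → (∀ x → P x ⊎ Q x) →
                        (xs : List A) → (∀ {x} → x ∈ xs → P x) ⊎ (∃[ x ] x ∈ xs × Q x)
all-or-counterexample dich [] = inj₁ λ ()
all-or-counterexample dich (x ∷ xs) with dich x | all-or-counterexample dich xs
... | inj₂ q | _                   = inj₂ (x , here refl , q)
... | inj₁ p | inj₁ ps             = inj₁ λ { (here refl) → p ; (there m) → ps m }
... | inj₁ p | inj₂ (y , m , q)    = inj₂ (y , there m , q)

implies-or-refutes : {P Q : Set} → Dec P → Dec Q → (P → Q) ⊎ (P × ¬ Q)
implies-or-refutes _       (yes q) = inj₁ λ _ → q
implies-or-refutes (yes p) (no ¬q) = inj₂ (p , ¬q)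
implies-or-refutes (no ¬p) (no _)  = inj₁ λ p → ⊥-elim (¬p p)

-- Boolean semantics.  w ⊨ φ says that φ is true when its atoms and modal
-- subformulas are valued by w; the record makes w and φ inferable.
infix 4 _⊨_

record _⊨_ (w : Form → Bool) (φ : Form) : Set where
  constructor holds
  field evaluates : evalB w φ ≡ true
open _⊨_

⊨? : ∀ w φ → Dec (w ⊨ φ)
⊨? w φ = map′ holds evaluates (evalB w φ Bool.≟ true)

⊨-stable : ∀ {w φ} → ¬ ¬ w ⊨ φ → w ⊨ φ
⊨-stable {w} {φ} = decidable-stable (⊨? w φ)

⊨-~⁺ : ∀ {w φ} → ¬ w ⊨ φ → w ⊨ ~ φ
⊨-~⁺ ¬h = holds (cong not (Boolₚ.¬-not (¬h ∘ holds)))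

⊨-~⁻ : ∀ {w φ} → w ⊨ ~ φ → ¬ w ⊨ φ
⊨-~⁻ (holds h) (holds h') = Boolₚ.not-¬ (sym h') (sym h)

⊨-∧⁺ : ∀ {w φ ψ} → w ⊨ φ → w ⊨ ψ → w ⊨ φ ∧' ψ
⊨-∧⁺ (holds h) (holds h') = holds (cong₂ _∧_ h h')

⊨-∧⁻ : ∀ {w φ ψ} → w ⊨ φ ∧' ψ → w ⊨ φ × w ⊨ ψ
⊨-∧⁻ (holds h) = holds (proj₁ (both h)) , holds (proj₂ (both h))
  where
  both : ∀ {a b} → a ∧ b ≡ true → a ≡ true × b ≡ true
  both {true} h = refl , h

⊨-⇒⁺ : ∀ {w φ ψ} → (w ⊨ φ → w ⊨ ψ) → w ⊨ φ ⇒ ψ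
⊨-⇒⁺ f = ⊨-~⁺ λ h → let (hφ , h¬ψ) = ⊨-∧⁻ h in ⊨-~⁻ h¬ψ (f hφ)

⊨-⇒⁻ : ∀ {w φ ψ} → w ⊨ φ ⇒ ψ → w ⊨ φ → w ⊨ ψ
⊨-⇒⁻ h hφ = ⊨-stable λ ¬hψ → ⊨-~⁻ h (⊨-∧⁺ hφ (⊨-~⁺ ¬hψ))

⊤F : Form
⊤F = atom 0 ⇒ atom 0

⊨-⊤ : ∀ {w} → w ⊨ ⊤F
⊨-⊤ = ⊨-⇒⁺ id

⋀ : {A : Set} → (A → Form) → List A → Form
⋀ f []       = ⊤F
⋀ f (x ∷ xs) = f x ∧' ⋀ f xs

⊨-⋀⁺ : ∀ {A : Set} {w} (f : A → Form) xs → (∀ {x} → x ∈ xs → w ⊨ f x) → w ⊨ ⋀ f xs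
⊨-⋀⁺ f []       h = ⊨-⊤
⊨-⋀⁺ f (x ∷ xs) h = ⊨-∧⁺ (h (here refl)) (⊨-⋀⁺ f xs (h ∘ there))

⊨-⋀⁻ : ∀ {A : Set} {w} (f : A → Form) {xs x} → w ⊨ ⋀ f xs → x ∈ xs → w ⊨ f x
⊨-⋀⁻ f h (here refl) = proj₁ (⊨-∧⁻ h)
⊨-⋀⁻ f h (there m)   = ⊨-⋀⁻ f (proj₂ (⊨-∧⁻ h)) m

lit : Form → Bool → Form
lit b true  = b
lit b false = ~ b

⊨-lit⁺ : ∀ {w b} v → evalB w b ≡ v → w ⊨ lit b v
⊨-lit⁺ true  e = holds e
⊨-lit⁺ false e = ⊨-~⁺ λ h → Boolₚ.not-¬ e (evaluates h)

⊨-lit⁻ : ∀ {w b} v → w ⊨ lit b v → evalB w b ≡ v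
⊨-lit⁻ true  h = evaluates h
⊨-lit⁻ false h = Boolₚ.¬-not λ e → ⊨-~⁻ h (holds e)

tautological : ∀ {Ψ χ} → All (⊢_) Ψ → (∀ w → All (w ⊨_) Ψ → w ⊨ χ) → ⊢ χ
tautological []       sem = taut λ w → evaluates (sem w [])
tautological (p ∷ ps) sem = mp (tautological ps λ w hs → ⊨-⇒⁺ λ h → sem w (h ∷ hs)) p

⇒-trans : ∀ {φ ψ χ} → ⊢ (φ ⇒ ψ) → ⊢ (ψ ⇒ χ) → ⊢ (φ ⇒ χ)
⇒-trans p q = tautological (p ∷ q ∷ []) λ { w (h₁ ∷ h₂ ∷ []) → ⊨-⇒⁺ (⊨-⇒⁻ h₂ ∘ ⊨-⇒⁻ h₁) }

ex-falso : ∀ {φ ψ} → ⊢ (~ φ) → ⊢ (φ ⇒ ψ)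
ex-falso p = tautological (p ∷ []) λ { w (h ∷ []) → ⊨-⇒⁺ λ hφ → ⊥-elim (⊨-~⁻ h hφ) }

-- The two modalities of EK.  Both are normal and satisfy the T axiom; the
-- lemmas below hold for either.
data Modality : Set where
  𝔼 𝕂 : Modality

□ : Modality → Form → Form
□ 𝔼 = E
□ 𝕂 = K

□-nec : ∀ m {φ} → ⊢ φ → ⊢ □ m φ
□-nec 𝔼 = E-nec
□-nec 𝕂 = K-nec

□-dist : ∀ m {φ ψ} → ⊢ (□ m (φ ⇒ ψ) ⇒ (□ m φ ⇒ □ m ψ))
□-dist 𝔼 = E-K
□-dist 𝕂 = K-K

□-T : ∀ m {φ} → ⊢ (□ m φ ⇒ φ)
□-T 𝔼 = E-T
□-T 𝕂 = K-T

□-mono : ∀ m {φ ψ} → ⊢ (φ ⇒ ψ) → ⊢ (□ m φ ⇒ □ m ψ)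
□-mono m p = mp (□-dist m) (□-nec m p)

□-∧ : ∀ m {X φ ψ} → ⊢ (X ⇒ □ m φ) → ⊢ (X ⇒ □ m ψ) → ⊢ (X ⇒ □ m (φ ∧' ψ))
□-∧ m p q = tautological (p ∷ q ∷ □-mono m pairing ∷ □-dist m ∷ [])
  λ { w (h₁ ∷ h₂ ∷ h₃ ∷ h₄ ∷ []) → ⊨-⇒⁺ λ x → ⊨-⇒⁻ (⊨-⇒⁻ h₄ (⊨-⇒⁻ h₃ (⊨-⇒⁻ h₁ x))) (⊨-⇒⁻ h₂ x) }
  where
  pairing : ∀ {φ ψ} → ⊢ (φ ⇒ (ψ ⇒ φ ∧' ψ))
  pairing = tautological [] λ w _ → ⊨-⇒⁺ λ a → ⊨-⇒⁺ λ b → ⊨-∧⁺ a b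

□-⊤ : ∀ m {X} → ⊢ (X ⇒ □ m ⊤F)
□-⊤ m = tautological (□-nec m (tautological [] λ _ _ → ⊨-⊤) ∷ []) λ { w (h ∷ []) → ⊨-⇒⁺ λ _ → h }

□-⋀ : ∀ m {A : Set} {X} (f : A → Form) xs → (∀ {x} → x ∈ xs → ⊢ (X ⇒ □ m (f x))) → ⊢ (X ⇒ □ m (⋀ f xs))
□-⋀ m f [] _ = □-⊤ m
□-⋀ m f (x ∷ xs) p = □-∧ m (p (here refl)) (□-⋀ m f xs (p ∘ there))

-- Basic formulas are those that evalB treats as propositional variables;
-- bas φ lists the basic subformulas of φ.
bas : Form → List Form
bas (atom p) = atom p ∷ []
bas (~ φ)    = bas φ
bas (φ ∧' ψ) = bas φ ++ bas ψ
bas (E φ)    = E φ ∷ bas φ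
bas (K φ)    = K φ ∷ bas φ

data Basic : Form → Set where
  atom : ∀ p → Basic (atom p)
  E    : ∀ φ → Basic (E φ)
  K    : ∀ φ → Basic (K φ)

basic-eval : ∀ {b} w → Basic b → evalB w b ≡ w b
basic-eval w (atom p) = refl
basic-eval w (E φ)    = refl
basic-eval w (K φ)    = refl

bas-basic : ∀ φ {b} → b ∈ bas φ → Basic b
bas-basic (atom p) (here refl) = atom p
bas-basic (~ φ)    m = bas-basic φ m
bas-basic (φ ∧' ψ) m = [ bas-basic φ , bas-basic ψ ]′ (∈-++⁻ (bas φ) m)
bas-basic (E φ) (here refl) = E φ
bas-basic (E φ) (there m)   = bas-basic φ m
bas-basic (K φ) (here refl) = K φ
bas-basic (K φ) (there m)   = bas-basic φ m

bas-closed : ∀ φ {b} → b ∈ bas φ → bas b ⊆ bas φ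
bas-closed (atom p) (here refl) = id
bas-closed (~ φ)    m = bas-closed φ m
bas-closed (φ ∧' ψ) m with ∈-++⁻ (bas φ) m
... | inj₁ mφ = ∈-++⁺ˡ ∘ bas-closed φ mφ
... | inj₂ mψ = ∈-++⁺ʳ (bas φ) ∘ bas-closed ψ mψ
bas-closed (E φ) (here refl) = id
bas-closed (E φ) (there m)   = there ∘ bas-closed φ m
bas-closed (K φ) (here refl) = id
bas-closed (K φ) (there m)   = there ∘ bas-closed φ m

eval-local : ∀ φ {w w′} → (∀ {b} → b ∈ bas φ → w b ≡ w′ b) → evalB w φ ≡ evalB w′ φ
eval-local (atom p) agree = agree (here refl)
eval-local (~ φ)    agree = cong not (eval-local φ agree)
eval-local (φ ∧' ψ) agree =
  cong₂ _∧_ (eval-local φ (agree ∘ ∈-++⁺ˡ)) (eval-local ψ (agree ∘ ∈-++⁺ʳ (bas φ)))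
eval-local (E φ)    agree = agree (here refl)
eval-local (K φ)    agree = agree (here refl)

_≟F_ : DecidableEquality Form
atom p   ≟F atom q   = map′ (cong atom) (λ { refl → refl }) (p ℕ.≟ q)
(~ φ)    ≟F (~ ψ)    = map′ (cong ~_) (λ { refl → refl }) (φ ≟F ψ)
(φ ∧' ψ) ≟F (χ ∧' ρ) with φ ≟F χ | ψ ≟F ρ
... | yes refl | yes refl = yes refl
... | no φ≢χ   | _        = no λ { refl → φ≢χ refl }
... | yes _    | no ψ≢ρ   = no λ { refl → ψ≢ρ refl }
E φ      ≟F E ψ      = map′ (cong E) (λ { refl → refl }) (φ ≟F ψ)
K φ      ≟F K ψ      = map′ (cong K) (λ { refl → refl }) (φ ≟F ψ)
atom _   ≟F (~ _)    = no λ ()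
atom _   ≟F (_ ∧' _) = no λ ()
atom _   ≟F E _      = no λ ()
atom _   ≟F K _      = no λ ()
(~ _)    ≟F atom _   = no λ ()
(~ _)    ≟F (_ ∧' _) = no λ ()
(~ _)    ≟F E _      = no λ ()
(~ _)    ≟F K _      = no λ ()
(_ ∧' _) ≟F atom _   = no λ ()
(_ ∧' _) ≟F (~ _)    = no λ ()
(_ ∧' _) ≟F E _      = no λ ()
(_ ∧' _) ≟F K _      = no λ ()
E _      ≟F atom _   = no λ ()
E _      ≟F (~ _)    = no λ ()
E _      ≟F (_ ∧' _) = no λ ()
E _      ≟F K _      = no λ ()
K _      ≟F atom _   = no λ ()
K _      ≟F (~ _)    = no λ ()
K _      ≟F (_ ∧' _) = no λ ()
K _      ≟F E _      = no λ ()

readoff : List Form → List Bool → Form → Bool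
readoff (c ∷ L) (v ∷ vs) b with b ≟F c
... | yes _ = v
... | no _  = readoff L vs b
readoff _ _ _ = false

readoff-map : ∀ (w : Form → Bool) L {b} → b ∈ L → readoff L (map w L) b ≡ w b
readoff-map w (c ∷ L) {b} m with b ≟F c | m
... | yes refl | _         = refl
... | no b≢c   | here b≡c  = ⊥-elim (b≢c b≡c)
... | no _     | there m′  = readoff-map w L m′

labellings : {A : Set} → List A → List (List Bool)
labellings []       = [] ∷ []
labellings (_ ∷ xs) = map (true ∷_) (labellings xs) ++ map (false ∷_) (labellings xs)

labelling-listed : {A : Set} (f : A → Bool) (xs : List A) → map f xs ∈ labellings xs
labelling-listed f [] = here refl
labelling-listed f (x ∷ xs) with f x
... | true  = ∈-++⁺ˡ (∈-map⁺ (true ∷_) (labelling-listed f xs))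
... | false = ∈-++⁺ʳ (map (true ∷_) (labellings xs)) (∈-map⁺ (false ∷_) (labelling-listed f xs))

-- The construction, for a finite list B of basic formulas that is closed under
-- basic subformulas and contains the atom used by ⊤F.
module Elimination (B : List Form)
                   (B-basic : ∀ {b} → b ∈ B → Basic b)
                   (B-closed : ∀ {b} → b ∈ B → bas b ⊆ B)
                   (atom0∈B : atom 0 ∈ B) where

  record Over (θ : Form) : Set where
    constructor over
    field within : bas θ ⊆ B
  open Over

  over-∧ : ∀ {φ ψ} → Over φ → Over ψ → Over (φ ∧' ψ)
  over-∧ {φ} oφ oψ = over λ m → [ within oφ , within oψ ]′ (∈-++⁻ (bas φ) m)

  over-~ : ∀ {φ} → Over φ → Over (~ φ)
  over-~ o = over (within o)

  over-⊤ : Over ⊤F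
  over-⊤ = over λ { (here refl) → atom0∈B ; (there (here refl)) → atom0∈B }

  over-⋀ : ∀ {A : Set} (f : A → Form) xs → (∀ {x} → x ∈ xs → Over (f x)) → Over (⋀ f xs)
  over-⋀ f []       _ = over-⊤
  over-⋀ f (x ∷ xs) o = over-∧ (o (here refl)) (over-⋀ f xs (o ∘ there))

  over-lit : ∀ {b} v → Over b → Over (lit b v)
  over-lit true  o = o
  over-lit false o = over-~ o

  over-member : ∀ {b} → b ∈ B → Over b
  over-member b∈B = over (B-closed b∈B)

  over-body : ∀ m {a} → Over (□ m a) → Over a
  over-body 𝔼 o = over (within o ∘ there)
  over-body 𝕂 o = over (within o ∘ there)

  Asg : Set
  Asg = List Bool

  V : Asg → Form → Bool
  V = readoff B

  _⊩_ : Asg → Form → Set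
  t ⊩ θ = V t ⊨ θ
  infix 4 _⊩_

  ⊩? : ∀ t θ → Dec (t ⊩ θ)
  ⊩? t = ⊨? (V t)

  AS : List Asg
  AS = labellings B

  char : Asg → Form
  char t = ⋀ (λ b → lit b (V t b)) B

  char-sound : ∀ {w t b} → w ⊨ char t → b ∈ B → w b ≡ V t b
  char-sound {w} {t} {b} c b∈B =
    trans (sym (basic-eval w (B-basic b∈B))) (⊨-lit⁻ (V t b) (⊨-⋀⁻ (λ b → lit b (V t b)) c b∈B))

  char-self : ∀ w → w ⊨ char (map w B)
  char-self w = ⊨-⋀⁺ _ B λ b∈B →
    ⊨-lit⁺ _ (trans (basic-eval w (B-basic b∈B)) (sym (readoff-map w B b∈B)))

  char-decides : ∀ {t θ} → Over θ → t ⊩ θ → ⊢ (char t ⇒ θ)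
  char-decides {t} {θ} o h = tautological [] λ w _ → ⊨-⇒⁺ λ c →
    holds (trans (eval-local θ (λ m → char-sound c (within o m))) (evaluates h))

  cover : ∀ {θ} → (∀ {u} → u ∈ AS → ⊢ (char u ⇒ θ)) → ⊢ θ
  cover {θ} p = tautological (Allₚ.map⁺ (All.tabulate p)) λ w hs →
    ⊨-⇒⁻ (All.lookup (Allₚ.map⁻ hs) (labelling-listed w B)) (char-self w)

  -- An assignment is kept or refuted: the invariant of the elimination.
  Exhaustive : List Asg → Set
  Exhaustive S = ∀ {u} → u ∈ AS → u ∈ S ⊎ ⊢ (~ char u)

  by-kept : ∀ {S θ} → Exhaustive S → Over θ → (∀ {u} → u ∈ S → u ⊩ θ) → ⊢ θ
  by-kept exh o true-at = cover λ u∈AS →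
    [ (λ u∈S → char-decides o (true-at u∈S)) , ex-falso ]′ (exh u∈AS)

  -- What t requires of its successors: for K, the same K-literals; for E, in
  -- addition, the bodies of the E-formulas of B true at t.
  K-literal : Asg → Form → Form
  K-literal t (K c) = lit (K c) (V t (K c))
  K-literal t _     = ⊤F

  E-body : Asg → Form → Form
  E-body t (E c) = if V t (E c) then c else ⊤F
  E-body t _     = ⊤F

  access : Modality → Asg → Form
  access 𝕂 t = ⋀ (K-literal t) B
  access 𝔼 t = ⋀ (K-literal t) B ∧' ⋀ (E-body t) B

  over-access : ∀ m t → Over (access m t)
  over-access 𝕂 t = over-⋀ (K-literal t) B K-literal-over
    where
    K-literal-over : ∀ {b} → b ∈ B → Over (K-literal t b)
    K-literal-over {K c}    b∈B = over-lit (V t (K c)) (over-member b∈B)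
    K-literal-over {atom _} _   = over-⊤
    K-literal-over {~ _}    _   = over-⊤
    K-literal-over {_ ∧' _} _   = over-⊤
    K-literal-over {E _}    _   = over-⊤
  over-access 𝔼 t = over-∧ (over-access 𝕂 t) (over-⋀ (E-body t) B E-body-over)
    where
    E-body-over : ∀ {b} → b ∈ B → Over (E-body t b)
    E-body-over {E c} b∈B with V t (E c)
    ... | true  = over-body 𝔼 (over-member b∈B)
    ... | false = over-⊤
    E-body-over {atom _} _ = over-⊤
    E-body-over {~ _}    _ = over-⊤
    E-body-over {_ ∧' _} _ = over-⊤
    E-body-over {K _}    _ = over-⊤

  -- char t forces its requirement necessarily: by introspection (K4, K5) for the
  -- K-literals, and through K φ → E φ for evidence.
  char-K-literals : ∀ t → ⊢ (char t ⇒ K (⋀ (K-literal t) B))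
  char-K-literals t = □-⋀ 𝕂 (K-literal t) B boxed
    where
    boxed : ∀ {b} → b ∈ B → ⊢ (char t ⇒ K (K-literal t b))
    boxed {K c} b∈B with V t (K c) in eq
    ... | true  = ⇒-trans (char-decides (over-member b∈B) (holds eq)) K-4
    ... | false = ⇒-trans (char-decides (over-~ (over-member b∈B)) (⊨-lit⁺ false eq)) K-5
    boxed {atom _} _ = □-⊤ 𝕂
    boxed {~ _}    _ = □-⊤ 𝕂
    boxed {_ ∧' _} _ = □-⊤ 𝕂
    boxed {E _}    _ = □-⊤ 𝕂

  char-access : ∀ m t → ⊢ (char t ⇒ □ m (access m t))
  char-access 𝕂 t = char-K-literals t
  char-access 𝔼 t = □-∧ 𝔼 (⇒-trans (char-K-literals t) KE) (□-⋀ 𝔼 (E-body t) B boxed)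
    where
    boxed : ∀ {b} → b ∈ B → ⊢ (char t ⇒ E (E-body t b))
    boxed {E c} b∈B with V t (E c) in eq
    ... | true  = char-decides (over-member b∈B) (holds eq)
    ... | false = □-⊤ 𝔼
    boxed {atom _} _ = □-⊤ 𝔼
    boxed {~ _}    _ = □-⊤ 𝔼
    boxed {_ ∧' _} _ = □-⊤ 𝔼
    boxed {K _}    _ = □-⊤ 𝔼

  record Coherent (S : List Asg) (t : Asg) (m : Modality) (a : Form) : Set where
    field
      reflected : t ⊩ □ m a → t ⊩ a
      witnessed : ¬ t ⊩ □ m a → ∃[ u ] u ∈ S × u ⊩ access m t × ¬ u ⊩ a

  data Defect (S : List Asg) (t : Asg) (m : Modality) (a : Form) : Set where
    unreflected : t ⊩ □ m a → ¬ t ⊩ a → Defect S t m a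
    unwitnessed : ¬ t ⊩ □ m a → (∀ {u} → u ∈ S → u ⊩ access m t → u ⊩ a) → Defect S t m a

  coherent? : ∀ S t m a → Coherent S t m a ⊎ Defect S t m a
  coherent? S t m a with ⊩? t (□ m a)
  ... | yes box with ⊩? t a
  ...   | yes body = inj₁ record { reflected = λ _ → body ; witnessed = λ ¬box → ⊥-elim (¬box box) }
  ...   | no ¬body = inj₂ (unreflected box ¬body)
  coherent? S t m a | no ¬box
      with all-or-counterexample (λ u → implies-or-refutes (⊩? u (access m t)) (⊩? u a)) S
  ... | inj₁ implied           = inj₂ (unwitnessed ¬box implied)
  ... | inj₂ (u , u∈S , fails) = inj₁ record
    { reflected = λ box → ⊥-elim (¬box box)
    ; witnessed = λ _ → u , u∈S , fails }

  -- An unreflected one contradicts the T axiom.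
  -- For an unwitnessed one, every kept assignment satisfies  access m t ⇒ a , so
  -- □ₘ (access m t) ⇒ □ₘ a is a theorem, while char t gives the antecedent and ¬ □ₘ a.
  refute : ∀ {S t m a} → Exhaustive S → □ m a ∈ B → Defect S t m a → ⊢ (~ char t)
  refute {m = m} {a} exh □a∈B (unreflected box ¬body) =
    tautological (char-decides (over-∧ o□a (over-~ (over-body m o□a))) (⊨-∧⁺ box (⊨-~⁺ ¬body)) ∷ □-T m ∷ [])
      λ { w (h₁ ∷ h₂ ∷ []) → ⊨-~⁺ λ c → let (h□ , h¬) = ⊨-∧⁻ (⊨-⇒⁻ h₁ c) in ⊨-~⁻ h¬ (⊨-⇒⁻ h₂ h□) }
    where
    o□a : Over (□ m a)
    o□a = over-member □a∈B
  refute {t = t} {m} {a} exh □a∈B (unwitnessed ¬box implied) =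
    tautological (char-access m t ∷ □-mono m access⇒a ∷ char-decides (over-~ o□a) (⊨-~⁺ ¬box) ∷ [])
      λ { w (h₁ ∷ h₂ ∷ h₃ ∷ []) → ⊨-~⁺ λ c → ⊨-~⁻ (⊨-⇒⁻ h₃ c) (⊨-⇒⁻ h₂ (⊨-⇒⁻ h₁ c)) }
    where
    o□a : Over (□ m a)
    o□a = over-member □a∈B
    access⇒a : ⊢ (access m t ⇒ a)
    access⇒a = by-kept exh (over-~ (over-∧ (over-access m t) (over-~ (over-body m o□a)))) (⊨-⇒⁺ ∘ implied)

  Requirement : List Asg → Asg → Form → Set
  Requirement S t (E a) = Coherent S t 𝔼 a
  Requirement S t (K a) = Coherent S t 𝕂 a
  Requirement S t _     = ⊤

  Good : List Asg → Asg → Set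
  Good S t = ∀ {b} → b ∈ B → Requirement S t b

  coherent-at : ∀ {S t} m {a} → Good S t → □ m a ∈ B → Coherent S t m a
  coherent-at 𝔼 good = good
  coherent-at 𝕂 good = good

  FlawAt : List Asg → Asg → Form → Set
  FlawAt S t b = ∃[ m ] ∃[ a ] b ≡ □ m a × Defect S t m a

  Flaw : List Asg → Asg → Set
  Flaw S t = ∃[ b ] b ∈ B × FlawAt S t b

  requirement? : ∀ S t b → Requirement S t b ⊎ FlawAt S t b
  requirement? S t (E a)    = map₂ (λ d → 𝔼 , a , refl , d) (coherent? S t 𝔼 a)
  requirement? S t (K a)    = map₂ (λ d → 𝕂 , a , refl , d) (coherent? S t 𝕂 a)
  requirement? S t (atom _) = inj₁ tt
  requirement? S t (~ _)    = inj₁ tt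
  requirement? S t (_ ∧' _) = inj₁ tt

  good? : ∀ S t → Good S t ⊎ Flaw S t
  good? S t = all-or-counterexample (requirement? S t) B

  refute-flaw : ∀ {S t} → Exhaustive S → Flaw S t → ⊢ (~ char t)
  refute-flaw exh (_ , b∈B , _ , _ , refl , defect) = refute exh b∈B defect

  _≟A_ : DecidableEquality Asg
  _≟A_ = Listₚ.≡-dec Bool._≟_

  _without_ : List Asg → Asg → List Asg
  S without t = filter (λ u → ¬? (u ≟A t)) S

  without-shrinks : ∀ {S t} → t ∈ S → length (S without t) < length S
  without-shrinks {S} {t} t∈S =
    Listₚ.filter-notAll (λ u → ¬? (u ≟A t)) S (Any.map (λ t≡u u≢t → u≢t (sym t≡u)) t∈S)

  exhaustive-without : ∀ {S t} → Exhaustive S → ⊢ (~ char t) → Exhaustive (S without t)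
  exhaustive-without {S} {t} exh refuted {u} u∈AS with exh u∈AS | u ≟A t
  ... | inj₂ refuted-u | _        = inj₂ refuted-u
  ... | inj₁ _         | yes refl = inj₂ refuted
  ... | inj₁ u∈S       | no u≢t   = inj₁ (∈-filter⁺ (λ u → ¬? (u ≟A t)) u∈S u≢t)

  Stable : List Asg → Set
  Stable S = ∀ {t} → t ∈ S → Good S t

  -- Delete flawed assignments until none is left; n bounds the length of S.
  prune : ∀ n S → length S ≤ n → Exhaustive S → Σ[ S′ ∈ List Asg ] Exhaustive S′ × Stable S′
  prune zero    []      _ exh = [] , exh , λ ()
  prune zero    (_ ∷ _) ()
  prune (suc n) S     len exh with all-or-counterexample (good? S) S
  ... | inj₁ stable            = S , exh , stable
  ... | inj₂ (t , t∈S , flaw) =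
    prune n (S without t) (≤-pred (≤-trans (without-shrinks t∈S) len))
          (exhaustive-without exh (refute-flaw exh flaw))

  access-K-literals : ∀ m {t u} → u ⊩ access m t → u ⊩ ⋀ (K-literal t) B
  access-K-literals 𝕂 h = h
  access-K-literals 𝔼 h = proj₁ (⊨-∧⁻ h)

  same-K-values : ∀ {t u c} → u ⊩ ⋀ (K-literal t) B → K c ∈ B → V u (K c) ≡ V t (K c)
  same-K-values {t} {c = c} h Kc∈B = ⊨-lit⁻ (V t (K c)) (⊨-⋀⁻ (K-literal t) h Kc∈B)

  E-bodies : ∀ {t u c} → u ⊩ access 𝔼 t → E c ∈ B → t ⊩ E c → u ⊩ c
  E-bodies {t} {u} {c} h Ec∈B box =
    subst (λ v → u ⊩ (if v then c else ⊤F)) (evaluates box) (⊨-⋀⁻ (E-body t) (proj₂ (⊨-∧⁻ h)) Ec∈B)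

  self-access : ∀ {S t} → Stable S → t ∈ S → t ⊩ access 𝔼 t
  self-access {S} {t} stable t∈S =
    ⊨-∧⁺ (⊨-⋀⁺ (K-literal t) B own-K-literal) (⊨-⋀⁺ (E-body t) B own-E-body)
    where
    own-K-literal : ∀ {b} → b ∈ B → t ⊩ K-literal t b
    own-K-literal {K c}    _ = ⊨-lit⁺ (V t (K c)) refl
    own-K-literal {atom _} _ = ⊨-⊤
    own-K-literal {~ _}    _ = ⊨-⊤
    own-K-literal {_ ∧' _} _ = ⊨-⊤
    own-K-literal {E _}    _ = ⊨-⊤
    own-E-body : ∀ {b} → b ∈ B → t ⊩ E-body t b
    own-E-body {E c} Ec∈B with V t (E c) in eq
    ... | true  = Coherent.reflected (coherent-at 𝔼 (stable t∈S) Ec∈B) (holds eq)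
    ... | false = ⊨-⊤
    own-E-body {atom _} _ = ⊨-⊤
    own-E-body {~ _}    _ = ⊨-⊤
    own-E-body {_ ∧' _} _ = ⊨-⊤
    own-E-body {K _}    _ = ⊨-⊤

  -- The canonical model built from a stable list S and a member s₀: its worlds
  -- are the members of S valuing the K-formulas of B as s₀ does, there is a
  -- single evidence state, and y ∈ I(x) when y meets x's evidence requirement.
  module Canonical (S : List Asg) (stable : Stable S) (s₀ : Asg) (s₀∈S : s₀ ∈ S) where

    SameK : Asg → Set
    SameK u = ∀ {c} → K c ∈ B → V u (K c) ≡ V s₀ (K c)

    record World : Set where
      constructor world
      field
        state : Asg
        kept  : state ∈ S
        sameK : SameK state
    open World

    model : EvidenceModel
    model = record
      { X   = World
      ; x₀  = world s₀ s₀∈S (λ _ → refl)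
      ; Ev  = ⊤
      ; e₀  = tt
      ; I   = λ _ x y → state y ⊩ access 𝔼 (state x)
      ; val = λ p x → state x ⊩ atom p
      }

    in-U : ∀ x → EvidenceModel.U model tt x
    in-U x = self-access stable (kept x)

    model-E1 : E1 model
    model-E1 _ _ y _ = in-U y

    successor : ∀ m (x : World) {u} → u ∈ S → u ⊩ access m (state x) → World
    successor m x {u} u∈S h =
      world u u∈S (λ Kc∈B → trans (same-K-values (access-K-literals m h) Kc∈B) (sameK x Kc∈B))

    witness : ∀ m (x : World) {ψ} → □ m ψ ∈ B → ¬ state x ⊩ □ m ψ →
              Σ[ y ∈ World ] state y ⊩ access m (state x) × ¬ state y ⊩ ψ
    witness m x □ψ∈B ¬box with Coherent.witnessed (coherent-at m (stable (kept x)) □ψ∈B) ¬box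
    ... | u , u∈S , h , ¬body = successor m x u∈S h , h , ¬body

    truth : ∀ ψ → Over ψ → ∀ x → Sat model x tt ψ ⇔ state x ⊩ ψ
    truth (atom p) _ x = mk⇔ id id
    truth (~ ψ)    o x = mk⇔ (λ ¬sat → ⊨-~⁺ (¬sat ∘ Equivalence.from IH))
                             (λ h sat → ⊨-~⁻ h (Equivalence.to IH sat))
      where
      IH : Sat model x tt ψ ⇔ state x ⊩ ψ
      IH = truth ψ (over (within o)) x
    truth (φ ∧' ψ) o x = mk⇔ (λ (sφ , sψ) → ⊨-∧⁺ (Equivalence.to (IHφ x) sφ) (Equivalence.to (IHψ x) sψ))
                             (λ h → let (hφ , hψ) = ⊨-∧⁻ h in Equivalence.from (IHφ x) hφ , Equivalence.from (IHψ x) hψ)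
      where
      IHφ : ∀ y → Sat model y tt φ ⇔ state y ⊩ φ
      IHφ = truth φ (over (within o ∘ ∈-++⁺ˡ))
      IHψ : ∀ y → Sat model y tt ψ ⇔ state y ⊩ ψ
      IHψ = truth ψ (over (within o ∘ ∈-++⁺ʳ (bas φ)))
    truth (E ψ) o x = mk⇔ forward backward
      where
      IH : ∀ y → Sat model y tt ψ ⇔ state y ⊩ ψ
      IH = truth ψ (over-body 𝔼 o)
      forward : Sat model x tt (E ψ) → state x ⊩ E ψ
      forward sat = ⊨-stable λ ¬box →
        let (y , h , ¬body) = witness 𝔼 x (within o (here refl)) ¬box
        in ¬body (Equivalence.to (IH y) (proj₂ (sat y h)))
      backward : state x ⊩ E ψ → Sat model x tt (E ψ)
      backward box y h = in-U y , Equivalence.from (IH y) (E-bodies h (within o (here refl)) box)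
    truth (K ψ) o x = mk⇔ forward backward
      where
      IH : ∀ y → Sat model y tt ψ ⇔ state y ⊩ ψ
      IH = truth ψ (over-body 𝕂 o)
      K∈B : K ψ ∈ B
      K∈B = within o (here refl)
      forward : Sat model x tt (K ψ) → state x ⊩ K ψ
      forward sat = ⊨-stable λ ¬box →
        let (y , _ , ¬body) = witness 𝕂 x K∈B ¬box
        in ¬body (Equivalence.to (IH y) (proj₂ (sat y y (in-U y))))
      backward : state x ⊩ K ψ → Sat model x tt (K ψ)
      backward box _ y _ = in-U y , Equivalence.from (IH y)
        (Coherent.reflected (coherent-at 𝕂 (stable (kept y)) K∈B)
          (holds (trans (sameK y K∈B) (trans (sym (sameK x K∈B)) (evaluates box)))))

  complete : ∀ θ → Over θ → ValidE1 θ → ⊢ θ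
  complete θ o valid with prune (length AS) AS ≤-refl inj₁
  ... | S , exh , stable = by-kept exh o true-at
    where
    true-at : ∀ {u} → u ∈ S → u ⊩ θ
    true-at {u} u∈S = Equivalence.to (truth θ o x) (valid model model-E1 x tt (in-U x))
      where
      open Canonical S stable u u∈S
      x : World
      x = world u u∈S (λ _ → refl)

corollary1 : (φ : Form) → ValidE1 φ → ⊢ φ
corollary1 φ valid = complete φ (over there) valid
  where
  B : List Form
  B = atom 0 ∷ bas φ
  basic : ∀ {b} → b ∈ B → Basic b
  basic (here refl) = atom 0
  basic (there m)   = bas-basic φ m
  closed : ∀ {b} → b ∈ B → bas b ⊆ B
  closed (here refl) (here refl) = here refl
  closed (there m)   = there ∘ bas-closed φ m
  open Elimination B basic closed (here refl)
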